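{- For every $r<2$ there exists a WMST-instance $(G,\hat w,w)$ such that $$\frac{\mathrm{FtP}(\hat w,w)}{\mathrm{Opt}(w)}\ge 1+r\varepsilon,$$ where $\varepsilon=\eta/\mathrm{Opt}(w)$.
   Context: A WMST-instance is a triple $(G,\hat w,w)$ with $G=(V,E)$ a finite simple connected undirected graph, $n=|V|$, $m=|E|$, and $\hat w,w\colon E\to\mathbb{R}^+$ predicted and true edge weights. The algorithm knows $G$ and $\hat w$ in advance; true weights arrive one by one, and each edge must be irrevocably accepted or rejected upon arrival of its true weight. $\mathrm{Opt}(w)$ is the minimum true weight of a spanning tree. Error: with $p_e=|w(e)-\hat w(e)|$, $\eta$ is the sum of the $n-1$ largest values among $\{p_e\}_{e\in E}$, and $\varepsilon=\eta/\mathrm{Opt}(w)$. Algorithm FtP: compute a minimum spanning tree $T$ of $G$ with respect to $\hat w$ in advance and accept exactly the edges of $T$; $\mathrm{FtP}(\hat w,w)$ is the true weight of $T$.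
   Formalization: The parameter r ranges only over the rationals, and the edge weights $\hat w$ and $w$ of the instance are taken in the positive rationals rather than in $\mathbb{R}^+$. -}

module Defs where

open import Data.Nat as ℕ using (ℕ; zero; suc; _∸_)
open import Data.Fin using (Fin; zero; suc)
open import Data.Bool using (Bool; true; false; if_then_else_)
open import Data.Product using (Σ; _×_; _,_)
open import Data.Sum using (_⊎_)
open import Data.List using (List; []; _∷_; map; take; reverse; foldr)
open import Data.Rational using (ℚ; 0ℚ; 1ℚ; _+_; _-_; _*_; _≤_; _<_; ∣_∣)
open import Data.Rational.Properties using (≤-decTotalOrder)
open import Relation.Binary.PropositionalEquality using (_≡_; _≢_)
open import Data.List.Sort ≤-decTotalOrder using (sort)

record SimpleGraph : Set where
  field
    n : ℕ
    m : ℕ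
    src : Fin m → Fin n
    tgt : Fin m → Fin n
    loopless : ∀ e → src e ≢ tgt e
    noMulti : ∀ e f →
      ((src e ≡ src f) × (tgt e ≡ tgt f)) ⊎ ((src e ≡ tgt f) × (tgt e ≡ src f)) →
      e ≡ f

open SimpleGraph public

EdgeSet : SimpleGraph → Set
EdgeSet G = Fin (m G) → Bool

Links : (G : SimpleGraph) → Fin (m G) → Fin (n G) → Fin (n G) → Set
Links G e u v = ((src G e ≡ u) × (tgt G e ≡ v)) ⊎ ((src G e ≡ v) × (tgt G e ≡ u))

data Reach (G : SimpleGraph) (S : EdgeSet G) : Fin (n G) → Fin (n G) → Set where
  here : ∀ {u} → Reach G S u u
  step : ∀ {u v x} (e : Fin (m G)) → S e ≡ true → Links G e u v →
         Reach G S v x → Reach G S u x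

Connected : (G : SimpleGraph) → EdgeSet G → Set
Connected G S = ∀ u v → Reach G S u v

GraphConnected : SimpleGraph → Set
GraphConnected G = Connected G (λ _ → true)

sumFin : (k : ℕ) → (Fin k → ℚ) → ℚ
sumFin zero f = 0ℚ
sumFin (suc k) f = f zero + sumFin k (λ i → f (suc i))

card : {k : ℕ} → (Fin k → Bool) → ℕ
card {zero} S = 0
card {suc k} S = (if S zero then 1 else 0) ℕ.+ card (λ i → S (suc i))

SpanningTree : (G : SimpleGraph) → EdgeSet G → Set
SpanningTree G T = Connected G T × (card T ≡ n G ∸ 1)

Weights : SimpleGraph → Set
Weights G = Fin (m G) → ℚ

Positive : (G : SimpleGraph) → Weights G → Set
Positive G c = ∀ e → 0ℚ < c e

weight : (G : SimpleGraph) → Weights G → EdgeSet G → ℚ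
weight G c T = sumFin (m G) (λ e → if T e then c e else 0ℚ)

IsMST : (G : SimpleGraph) → Weights G → EdgeSet G → Set
IsMST G c T = SpanningTree G T × (∀ T' → SpanningTree G T' → weight G c T ≤ weight G c T')

allEdges : (k : ℕ) → List (Fin k)
allEdges zero = []
allEdges (suc k) = zero ∷ map suc (allEdges k)

sumList : List ℚ → ℚ
sumList = foldr _+_ 0ℚ

eta : (G : SimpleGraph) → (ŵ w : Weights G) → ℚ
eta G ŵ w = sumList (take (n G ∸ 1) (reverse (sort (map (λ e → ∣ w e - ŵ e ∣) (allEdges (m G))))))

two : ℚ
two = 1ℚ + 1ℚ

{-# OPTIONS --safe #-}
-- Take a graph with two edge-disjoint spanning trees T₁ and T₂ (K₄ splits into two paths)
-- and put t = 2 - r > 0.  Predict weight 2 on T₁ and 2 + t elsewhere, while the true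
-- weights are 3 + t on T₁ and 1 elsewhere.  Every edge then has error 1 + t, so
-- η = N (1 + t) with N = n - 1, and Opt ≤ w(T₂) = N.  The combination (2 + t) ŵ + t w
-- is the same on every edge and every spanning tree has N edges, so a tree minimising ŵ
-- maximises w: FtP ≥ w(T₁) = N (3 + t).  Finally N (3 + t) - N - r N (1 + t) = N t² ≥ 0.

module Submission where

open import Defs
open import Data.Product using (Σ; _×_)
open import Data.Rational using (ℚ; 0ℚ; _+_; _*_; _≤_; _<_)

open import Agda.Builtin.FromNat using (Number; fromNat)
open import Data.Bool using (Bool; true; false; not; if_then_else_)
open import Data.Bool.Properties using (not-injective)
open import Data.Fin using (Fin; zero; suc)
import Data.Fin.Properties as Fin
open import Data.List using (List; []; _∷_; map; length; take; reverse)
open import Data.List.Properties using (length-map; length-take)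
open import Data.List.Relation.Unary.All using (All; universal)
import Data.List.Relation.Unary.All as All
open import Data.List.Relation.Unary.All.Properties using (map⁺; take⁺)
open import Data.List.Relation.Binary.Permutation.Propositional using (_↭_; ↭-trans; ↭-sym)
open import Data.List.Relation.Binary.Permutation.Propositional.Properties
  using (All-resp-↭; ↭-length; ↭-reverse)
open import Data.Nat as ℕ using (ℕ; zero; suc; _∸_; _⊓_)
import Data.Nat.Literals
import Data.Nat.Properties as ℕ
open import Data.Product using (_,_; proj₁; proj₂)
open import Data.Sum using (inj₁; inj₂; swap)
open import Data.Rational using (1ℚ; _-_; -_; ∣_∣; positive; nonNegative)
import Data.Rational.Literals
open import Data.Rational.Properties
  using ( ≤-decTotalOrder; +-*-commutativeRing; ≤-refl; <⇒≤; +-mono-≤; +-monoʳ-≤; +-monoˡ-≤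
        ; +-mono-<-≤; +-identityˡ; +-identityʳ; *-zeroˡ; *-zeroʳ; *-identityˡ; *-distribʳ-+
        ; *-monoˡ-≤-nonNeg; *-cancelˡ-≤-pos; neg-antimono-≤; 0≤p⇒∣p∣≡p; ∣-p∣≡∣p∣; positive⁻¹
        ; ≤-trans; ≤-reflexive; +-mono-≤-<; +-mono-<; +-monoˡ-<; +-inverseʳ; module ≤-Reasoning)
  renaming (_≟_ to _≟ℚ_)
open import Data.List.Sort ≤-decTotalOrder using (sort; sort-↭)
open import Data.Unit using (tt)
open import Level using (0ℓ)
open import Relation.Binary.PropositionalEquality
open import Relation.Nullary.Decidable using (toWitness; dec⇒maybe; ¬?; _×-dec_; _⊎-dec_; _→-dec_)
open import Tactic.RingSolver using (solve-∀; solve)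
open import Tactic.RingSolver.Core.AlmostCommutativeRing
  using (AlmostCommutativeRing; fromCommutativeRing)

instance
  ℕ-number : Number ℕ
  ℕ-number = Data.Nat.Literals.number

  ℚ-number : Number ℚ
  ℚ-number = Data.Rational.Literals.number

ℚ-ring : AlmostCommutativeRing 0ℓ 0ℓ
ℚ-ring = fromCommutativeRing +-*-commutativeRing (λ x → dec⇒maybe (0ℚ ≟ℚ x))

fromℕ : ℕ → ℚ
fromℕ zero    = 0ℚ
fromℕ (suc k) = 1ℚ + fromℕ k

fromℕ-nonNeg : ∀ k → 0ℚ ≤ fromℕ k
fromℕ-nonNeg zero    = ≤-refl
fromℕ-nonNeg (suc k) = +-mono-≤ (<⇒≤ (positive⁻¹ 1ℚ)) (fromℕ-nonNeg k)

fromℕ-suc-* : ∀ k q → fromℕ (suc k) * q ≡ q + fromℕ k * q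
fromℕ-suc-* k q = trans (*-distribʳ-+ q 1ℚ (fromℕ k)) (cong (_+ fromℕ k * q) (*-identityˡ q))

*-nonNeg : ∀ {p q} → 0ℚ ≤ p → 0ℚ ≤ q → 0ℚ ≤ p * q
*-nonNeg {p} {q} 0≤p 0≤q = subst (_≤ p * q) (*-zeroʳ p) (*-monoˡ-≤-nonNeg p {{nonNegative 0≤p}} 0≤q)

x+y≡z⇒y≡z-x : ∀ {x y z} → x + y ≡ z → y ≡ z - x
x+y≡z⇒y≡z-x {x} {y} refl = solve (x ∷ y ∷ []) ℚ-ring

p≤p+q : ∀ p {q} → 0ℚ ≤ q → p ≤ p + q
p≤p+q p 0≤q = ≤-trans (≤-reflexive (sym (+-identityʳ p))) (+-monoʳ-≤ p 0≤q)

p<q⇒0<q-p : ∀ {p q} → p < q → 0ℚ < q - p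
p<q⇒0<q-p {p} {q} p<q = subst (_< q - p) (+-inverseʳ p) (+-monoˡ-< (- p) p<q)

+-*-interchange : ∀ a b x y X Y → a * (x + X) + b * (y + Y) ≡ (a * x + b * y) + (a * X + b * Y)
+-*-interchange = solve-∀ ℚ-ring

sumFin-cong : ∀ k {f g : Fin k → ℚ} → (∀ i → f i ≡ g i) → sumFin k f ≡ sumFin k g
sumFin-cong zero    f≡g = refl
sumFin-cong (suc k) f≡g = cong₂ _+_ (f≡g zero) (sumFin-cong k (λ i → f≡g (suc i)))

sumFin-linear : ∀ k a b (f g : Fin k → ℚ) →
  a * sumFin k f + b * sumFin k g ≡ sumFin k (λ i → a * f i + b * g i)
sumFin-linear zero    a b f g = solve (a ∷ b ∷ []) ℚ-ring
sumFin-linear (suc k) a b f g =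
  trans (+-*-interchange a b (f zero) (g zero) _ _)
        (cong ((a * f zero + b * g zero) +_)
              (sumFin-linear k a b (λ i → f (suc i)) (λ i → g (suc i))))

if-linear : ∀ s a b x y →
  a * (if s then x else 0ℚ) + b * (if s then y else 0ℚ) ≡ (if s then a * x + b * y else 0ℚ)
if-linear true  a b x y = refl
if-linear false a b x y = solve (a ∷ b ∷ []) ℚ-ring

-- weight G unfolds to weightFin (m G); stating the lemmas for an arbitrary number of
-- edges k is what makes them provable by induction.
weightFin : (k : ℕ) → (Fin k → ℚ) → (Fin k → Bool) → ℚ
weightFin k c S = sumFin k (λ i → if S i then c i else 0ℚ)

card-≤ : ∀ {k} (S : Fin k → Bool) → card S ℕ.≤ k
card-≤ {zero}  S = ℕ.z≤n
card-≤ {suc k} S with S zero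
... | true  = ℕ.s≤s (card-≤ (λ i → S (suc i)))
... | false = ℕ.m≤n⇒m≤1+n (card-≤ (λ i → S (suc i)))

weightFin-const : ∀ {k} (c : Fin k → ℚ) (S : Fin k → Bool) {q} →
  (∀ i → S i ≡ true → c i ≡ q) → weightFin k c S ≡ fromℕ (card S) * q
weightFin-const {zero}  c S {q} _   = sym (*-zeroˡ q)
weightFin-const {suc k} c S {q} c≡q with S zero in S₀
... | true  = trans (cong₂ _+_ (c≡q zero S₀) (weightFin-const _ _ (λ i → c≡q (suc i))))
                    (sym (fromℕ-suc-* (card (λ i → S (suc i))) q))
... | false = trans (+-identityˡ _) (weightFin-const _ _ (λ i → c≡q (suc i)))

weightFin-linear : ∀ {k} a b (c d : Fin k → ℚ) (S : Fin k → Bool) →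
  a * weightFin k c S + b * weightFin k d S ≡ weightFin k (λ i → a * c i + b * d i) S
weightFin-linear {k} a b c d S =
  trans (sumFin-linear k a b _ _) (sumFin-cong k (λ i → if-linear (S i) a b (c i) (d i)))

weightFin-affine : ∀ {k} a b {K} (c d : Fin k → ℚ) → (∀ i → a * c i + b * d i ≡ K) →
  ∀ S → a * weightFin k c S + b * weightFin k d S ≡ fromℕ (card S) * K
weightFin-affine a b c d affine S =
  trans (weightFin-linear a b c d S) (weightFin-const _ S (λ i _ → affine i))

weightFin-nonNeg : ∀ {k} (c : Fin k → ℚ) (S : Fin k → Bool) →
  (∀ i → 0ℚ ≤ c i) → 0ℚ ≤ weightFin k c S
weightFin-nonNeg {zero}  c S 0≤c = ≤-refl
weightFin-nonNeg {suc k} c S 0≤c with S zero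
... | true  = +-mono-≤ (0≤c zero) (weightFin-nonNeg _ _ (λ i → 0≤c (suc i)))
... | false = +-mono-≤ ≤-refl (weightFin-nonNeg _ _ (λ i → 0≤c (suc i)))

weightFin-pos : ∀ {k} (c : Fin k → ℚ) (S : Fin k → Bool) →
  (∀ i → 0ℚ < c i) → 0 ℕ.< card S → 0ℚ < weightFin k c S
weightFin-pos {suc k} c S 0<c 0<∣S∣ with S zero
... | true  = +-mono-<-≤ (0<c zero) (weightFin-nonNeg _ _ (λ i → <⇒≤ (0<c (suc i))))
... | false = +-mono-≤-< ≤-refl (weightFin-pos _ _ (λ i → 0<c (suc i)) 0<∣S∣)

sumList-const : ∀ {q} {xs : List ℚ} → All (_≡ q) xs → sumList xs ≡ fromℕ (length xs) * q
sumList-const {q} All.[]                     = sym (*-zeroˡ q)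
sumList-const {q} {_ ∷ xs} (refl All.∷ xs≡q) =
  trans (cong (q +_) (sumList-const xs≡q)) (sym (fromℕ-suc-* (length xs) q))

length-allEdges : ∀ k → length (allEdges k) ≡ k
length-allEdges zero    = refl
length-allEdges (suc k) = cong suc (trans (length-map suc (allEdges k)) (length-allEdges k))

eta-const : ∀ G (ŵ w : Weights G) {q} → (∀ e → ∣ w e - ŵ e ∣ ≡ q) →
  eta G ŵ w ≡ fromℕ ((n G ∸ 1) ⊓ m G) * q
eta-const G ŵ w {q} error≡q = begin
  sumList (take N sorted)              ≡⟨ sumList-const (take⁺ N sorted≡q) ⟩
  fromℕ (length (take N sorted)) * q  ≡⟨ cong (λ k → fromℕ k * q) length-taken ⟩
  fromℕ (N ⊓ m G) * q                 ∎
  where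
  open ≡-Reasoning
  N : ℕ
  N = n G ∸ 1
  errors sorted : List ℚ
  errors = map (λ e → ∣ w e - ŵ e ∣) (allEdges (m G))
  sorted = reverse (sort errors)
  errors↭sorted : errors ↭ sorted
  errors↭sorted = ↭-sym (↭-trans (↭-reverse (sort errors)) (sort-↭ errors))
  sorted≡q : All (_≡ q) sorted
  sorted≡q = All-resp-↭ errors↭sorted (map⁺ (universal error≡q (allEdges (m G))))
  length-sorted : length sorted ≡ m G
  length-sorted = trans (sym (↭-length errors↭sorted))
                        (trans (length-map _ (allEdges (m G))) (length-allEdges (m G)))
  length-taken : length (take N sorted) ≡ N ⊓ m G
  length-taken = trans (length-take N sorted) (cong (N ⊓_) length-sorted)

module _ {G : SimpleGraph} where

  forward : ∀ {S x} e → S e ≡ true → Reach G S (tgt G e) x → Reach G S (src G e) x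
  forward e on = step e on (inj₁ (refl , refl))

  backward : ∀ {S x} e → S e ≡ true → Reach G S (src G e) x → Reach G S (tgt G e) x
  backward e on = step e on (inj₂ (refl , refl))

  Reach-trans : ∀ {S u v x} → Reach G S u v → Reach G S v x → Reach G S u x
  Reach-trans here             v⇝x = v⇝x
  Reach-trans (step e p l u⇝v) v⇝x = step e p l (Reach-trans u⇝v v⇝x)

  Reach-sym : ∀ {S u v} → Reach G S u v → Reach G S v u
  Reach-sym here             = here
  Reach-sym (step e p l v⇝x) = Reach-trans (Reach-sym v⇝x) (step e p (swap l) here)

  Reach-mono : ∀ {S S′ u v} → (∀ e → S e ≡ true → S′ e ≡ true) → Reach G S u v → Reach G S′ u v
  Reach-mono S⊆S′ here             = here
  Reach-mono S⊆S′ (step e p l v⇝x) = step e (S⊆S′ e p) l (Reach-mono S⊆S′ v⇝x)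

  root⇒Connected : ∀ {S} root → (∀ u → Reach G S u root) → Connected G S
  root⇒Connected root ⇝root u v = Reach-trans (⇝root u) (Reach-sym (⇝root v))

IsMST-maximises : ∀ G (ŵ w : Weights G) {a b K : ℚ} → 0ℚ ≤ a → 0ℚ < b →
  (∀ e → a * ŵ e + b * w e ≡ K) →
  ∀ {T T′} → IsMST G ŵ T → SpanningTree G T′ → weight G w T′ ≤ weight G w T
IsMST-maximises G ŵ w {a} {b} {K} 0≤a 0<b affine {T} {T′} (tree , minimal) tree′ =
  *-cancelˡ-≤-pos b {{positive 0<b}} (begin
    b * weight G w T′      ≡⟨ on-tree tree′ ⟩
    C - a * weight G ŵ T′  ≤⟨ +-monoʳ-≤ C (neg-antimono-≤ a·ŵT≤a·ŵT′) ⟩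
    C - a * weight G ŵ T   ≡⟨ on-tree tree ⟨
    b * weight G w T       ∎)
  where
  open ≤-Reasoning
  C : ℚ
  C = fromℕ (n G ∸ 1) * K
  a·ŵT≤a·ŵT′ : a * weight G ŵ T ≤ a * weight G ŵ T′
  a·ŵT≤a·ŵT′ = *-monoˡ-≤-nonNeg a {{nonNegative 0≤a}} (minimal T′ tree′)
  on-tree : ∀ {S} → SpanningTree G S → b * weight G w S ≡ C - a * weight G ŵ S
  on-tree {S} (_ , ∣S∣≡n-1) =
    x+y≡z⇒y≡z-x (trans (weightFin-affine a b ŵ w affine S) (cong (λ k → fromℕ k * K) ∣S∣≡n-1))

FtP≥Opt+rη : (G : SimpleGraph) → Weights G → Weights G → ℚ → Set
FtP≥Opt+rη G ŵ w r = ∀ T → IsMST G ŵ T → ∀ T* → IsMST G w T* →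
  (0ℚ < weight G w T*) × (weight G w T* + r * eta G ŵ w ≤ weight G w T)

slack : ∀ N r → N * (3 + (2 - r)) ≡ (N * 1 + r * (N * (1 + (2 - r)))) + N * ((2 - r) * (2 - r))
slack = solve-∀ ℚ-ring

module _ (G : SimpleGraph) (T₁ : EdgeSet G) (r : ℚ) where

  private
    t : ℚ
    t = 2 - r

  predicted actual : Weights G
  predicted e = if T₁ e then 2 else 2 + t
  actual    e = if T₁ e then 3 + t else 1

  predicted-actual-affine : ∀ e → (2 + t) * predicted e + t * actual e ≡ (1 + t) * (4 + t)
  predicted-actual-affine e with T₁ e
  ... | true  = on-T₁ t
    where on-T₁ : ∀ t → (2 + t) * 2 + t * (3 + t) ≡ (1 + t) * (4 + t)
          on-T₁ = solve-∀ ℚ-ring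
  ... | false = off-T₁ t
    where off-T₁ : ∀ t → (2 + t) * (2 + t) + t * 1 ≡ (1 + t) * (4 + t)
          off-T₁ = solve-∀ ℚ-ring

  private
    N : ℚ
    N = fromℕ (n G ∸ 1)

  weight-actual-T₁ : SpanningTree G T₁ → weight G actual T₁ ≡ N * (3 + t)
  weight-actual-T₁ (_ , ∣T₁∣≡n-1) =
    trans (weightFin-const actual T₁ (λ e on → cong (λ b → if b then 3 + t else 1) on))
          (cong (λ k → fromℕ k * (3 + t)) ∣T₁∣≡n-1)

  weight-actual-disjoint : ∀ {T₂} → SpanningTree G T₂ → (∀ e → T₂ e ≡ true → T₁ e ≡ false) →
    weight G actual T₂ ≡ N * 1
  weight-actual-disjoint {T₂} (_ , ∣T₂∣≡n-1) disjoint =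
    trans (weightFin-const actual T₂ (λ e on → cong (λ b → if b then 3 + t else 1) (disjoint e on)))
          (cong (λ k → fromℕ k * 1) ∣T₂∣≡n-1)

  module _ (r<2 : r < 2) where

    private
      0<t : 0ℚ < t
      0<t = p<q⇒0<q-p r<2

      0≤1+t : 0ℚ ≤ 1 + t
      0≤1+t = <⇒≤ (+-mono-< (positive⁻¹ 1) 0<t)

      0≤2+t : 0ℚ ≤ 2 + t
      0≤2+t = <⇒≤ (+-mono-< (positive⁻¹ 2) 0<t)

    predicted-positive : Positive G predicted
    predicted-positive e with T₁ e
    ... | true  = positive⁻¹ 2
    ... | false = +-mono-< (positive⁻¹ 2) 0<t

    actual-positive : Positive G actual
    actual-positive e with T₁ e
    ... | true  = +-mono-< (positive⁻¹ 3) 0<t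
    ... | false = positive⁻¹ 1

    actual-error : ∀ e → ∣ actual e - predicted e ∣ ≡ 1 + t
    actual-error e with T₁ e
    ... | true  = trans (cong ∣_∣ (overshoot t)) (0≤p⇒∣p∣≡p 0≤1+t)
      where overshoot : ∀ t → (3 + t) - 2 ≡ 1 + t
            overshoot = solve-∀ ℚ-ring
    ... | false = trans (cong ∣_∣ (undershoot t)) (trans (∣-p∣≡∣p∣ (1 + t)) (0≤p⇒∣p∣≡p 0≤1+t))
      where undershoot : ∀ t → 1 - (2 + t) ≡ - (1 + t)
            undershoot = solve-∀ ℚ-ring

    eta-predicted-actual : SpanningTree G T₁ → eta G predicted actual ≡ N * (1 + t)
    eta-predicted-actual (_ , ∣T₁∣≡n-1) =
      trans (eta-const G predicted actual actual-error)
            (cong (λ k → fromℕ k * (1 + t))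
                  (ℕ.m≤n⇒m⊓n≡m (subst (ℕ._≤ m G) ∣T₁∣≡n-1 (card-≤ T₁))))

    predicted-actual-gap : 1 ℕ.< n G → SpanningTree G T₁ → ∀ {T₂} → SpanningTree G T₂ →
      (∀ e → T₂ e ≡ true → T₁ e ≡ false) → FtP≥Opt+rη G predicted actual r
    predicted-actual-gap 1<n tree₁ {T₂} tree₂ disjoint T ŵ-mst T* (tree* , w-minimal) =
      weightFin-pos actual T* actual-positive (subst (0 ℕ.<_) (sym (proj₂ tree*)) (ℕ.m<n⇒0<n∸m 1<n))
      ,
      (begin
        weight G actual T* + r * η  ≤⟨ +-monoˡ-≤ (r * η) (w-minimal T₂ tree₂) ⟩
        weight G actual T₂ + r * η  ≡⟨ cong₂ (λ x y → x + r * y) (weight-actual-disjoint tree₂ disjoint)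
                                                                  (eta-predicted-actual tree₁) ⟩
        N * 1 + r * (N * (1 + t))   ≤⟨ p≤p+q _ (*-nonNeg (fromℕ-nonNeg (n G ∸ 1))
                                                          (*-nonNeg (<⇒≤ 0<t) (<⇒≤ 0<t))) ⟩
        (N * 1 + r * (N * (1 + t))) + N * (t * t)
                                    ≡⟨ slack N r ⟨
        N * (3 + t)                 ≡⟨ weight-actual-T₁ tree₁ ⟨
        weight G actual T₁          ≤⟨ IsMST-maximises G predicted actual 0≤2+t 0<t
                                                       predicted-actual-affine ŵ-mst tree₁ ⟩
        weight G actual T           ∎)
      where
      open ≤-Reasoning
      η : ℚ
      η = eta G predicted actual

pattern v₀ = zero
pattern v₁ = suc zero
pattern v₂ = suc (suc zero)
pattern v₃ = suc (suc (suc zero))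

pattern e₀₁ = zero
pattern e₁₂ = suc zero
pattern e₂₃ = suc (suc zero)
pattern e₀₂ = suc (suc (suc zero))
pattern e₀₃ = suc (suc (suc (suc zero)))
pattern e₁₃ = suc (suc (suc (suc (suc zero))))

K₄-src K₄-tgt : Fin 6 → Fin 4
K₄-src e₀₁ = v₀
K₄-src e₁₂ = v₁
K₄-src e₂₃ = v₂
K₄-src e₀₂ = v₀
K₄-src e₀₃ = v₀
K₄-src e₁₃ = v₁
K₄-tgt e₀₁ = v₁
K₄-tgt e₁₂ = v₂
K₄-tgt e₂₃ = v₃
K₄-tgt e₀₂ = v₂
K₄-tgt e₀₃ = v₃
K₄-tgt e₁₃ = v₃

K₄ : SimpleGraph
K₄ = record
  { n        = 4
  ; m        = 6
  ; src      = K₄-src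
  ; tgt      = K₄-tgt
  ; loopless = toWitness {a? = Fin.all? λ e → ¬? (K₄-src e Fin.≟ K₄-tgt e)} tt
  ; noMulti  = toWitness {a? = Fin.all? λ e → Fin.all? λ f →
      (((K₄-src e Fin.≟ K₄-src f) ×-dec (K₄-tgt e Fin.≟ K₄-tgt f)) ⊎-dec
       ((K₄-src e Fin.≟ K₄-tgt f) ×-dec (K₄-tgt e Fin.≟ K₄-src f))) →-dec (e Fin.≟ f)} tt
  }

path : EdgeSet K₄
path e₀₁ = true
path e₁₂ = true
path e₂₃ = true
path _   = false

copath : EdgeSet K₄
copath e = not (path e)

path⇝v₀ : ∀ u → Reach K₄ path u v₀
path⇝v₀ v₀ = here
path⇝v₀ v₁ = backward e₀₁ refl here
path⇝v₀ v₂ = backward e₁₂ refl (backward e₀₁ refl here)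
path⇝v₀ v₃ = backward e₂₃ refl (backward e₁₂ refl (backward e₀₁ refl here))

copath⇝v₀ : ∀ u → Reach K₄ copath u v₀
copath⇝v₀ v₀ = here
copath⇝v₀ v₁ = forward e₁₃ refl (backward e₀₃ refl here)
copath⇝v₀ v₂ = backward e₀₂ refl here
copath⇝v₀ v₃ = backward e₀₃ refl here

path-spanning : SpanningTree K₄ path
path-spanning = root⇒Connected v₀ path⇝v₀ , refl

copath-spanning : SpanningTree K₄ copath
copath-spanning = root⇒Connected v₀ copath⇝v₀ , refl

mainTheorem6 : (r : ℚ) → r < two →
    Σ SimpleGraph λ G → GraphConnected G ×
    Σ (Weights G) λ ŵ → Σ (Weights G) λ w →
      Positive G ŵ × Positive G w ×
      (∀ T → IsMST G ŵ T → ∀ T* → IsMST G w T* →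
        (0ℚ < weight G w T*) × (weight G w T* + r * eta G ŵ w ≤ weight G w T))
mainTheorem6 r r<2 =
  K₄ , (λ u v → Reach-mono (λ _ _ → refl) (proj₁ path-spanning u v)) ,
  predicted K₄ path r , actual K₄ path r ,
  predicted-positive K₄ path r r<2 , actual-positive K₄ path r r<2 ,
  predicted-actual-gap K₄ path r r<2 (ℕ.s≤s (ℕ.s≤s ℕ.z≤n)) path-spanning copath-spanning
    (λ _ → not-injective)
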